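{- Let $n\ge1$ and $\lambda=(n,n)$. Then $$\xi(q)=\sum_k \vert S_k(\lambda)\vert q^k=\sum_{i=1}^{n} B(n-1,n-i)(1+q)^i=\sum_{i=1}^{n}\frac{i}{n}\binom{2n-i-1}{n-i}(1+q)^i .$$
   Context: $S_k(\lambda)$ is the set of fillings of the two-row Young diagram with rows of length $n$ (top) and $n$ (bottom) by $1,\dots,2n$, each used once, strictly increasing along rows, having exactly $k$ inversion pairs. For entries $i<j$ in the same column, with $i_k,j_k$ the entries $k$ boxes to their right, $(i,j)$ is an inversion pair if: (1) $i_1$ or $j_1$ does not exist and $i$ is below $j$; or (2) $i_1>j_1$; or (3) $i_k=j_k$ for $1\le k\le n'$, $i_{n'+1}$ or $j_{n'+1}$ does not exist, and $i$ is below $j$; or (4) $i_k=j_k$ for $1\le k\le n'$ and $i_{n'+1}>j_{n'+1}$. $B(\alpha,\beta)=\frac{\alpha-\beta+1}{\alpha+1}\binom{\alpha+\beta}{\alpha}$ is the ballot number. -}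

module Defs where

open import Data.Nat using (ℕ; zero; suc; _+_; _*_; _∸_; _<_; _<ᵇ_; _≡ᵇ_; _/_)
open import Data.Nat.Combinatorics using (_C_)
open import Data.Bool using (Bool; true; false; if_then_else_)
open import Data.List using (List; []; _∷_; _++_; map; upTo)
open import Data.Nat.ListAction using (sum)
open import Data.List.Relation.Binary.Permutation.Propositional using (_↭_)
open import Data.Vec using (Vec; toList; lookup)
open import Data.Fin using (Fin)
import Data.Fin as Fin
open import Data.Product using (Σ)
open import Relation.Binary.PropositionalEquality using (_≡_)

record Filling (n : ℕ) : Set where
  field
    top : Vec ℕ n
    bot : Vec ℕ n
    .topInc : ∀ (a b : Fin n) → a Fin.< b → lookup top a < lookup top b
    .botInc : ∀ (a b : Fin n) → a Fin.< b → lookup bot a < lookup bot b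
    .usesEachOnce : (toList top ++ toList bot) ↭ map suc (upTo (n + n))
open Filling public

-- Given the entries strictly to the right of i (list xs = i_1, i_2, ...)
-- and of j (list ys = j_1, j_2, ...), and whether i is below j, decide
-- whether (i,j) is an inversion pair, following clauses (1)-(4):
-- scan k = 1,2,... ; while i_k = j_k continue; if i_k or j_k does not
-- exist, inversion iff i is below j; if i_k > j_k inversion; if i_k < j_k not.
invFrom : List ℕ → List ℕ → Bool → Bool
invFrom []       _        iBelow = iBelow
invFrom (_ ∷ _)  []       iBelow = iBelow
invFrom (x ∷ xs) (y ∷ ys) iBelow =
  if y <ᵇ x then true else (if x ≡ᵇ y then invFrom xs ys iBelow else false)

-- Number of inversion pairs, scanning columns left to right.
-- In a column with top entry a and bottom entry b, the pair is (i,j) with i<j.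
invsRows : List ℕ → List ℕ → ℕ
invsRows (a ∷ as) (b ∷ bs) =
  (if a <ᵇ b then (if invFrom as bs false then 1 else 0)   -- i = a on top
             else (if invFrom bs as true  then 1 else 0))  -- i = b below
  + invsRows as bs
invsRows _ _ = 0

inversions : ∀ {n} → Filling n → ℕ
inversions F = invsRows (toList (top F)) (toList (bot F))

S : ℕ → ℕ → Set
S n k = Σ (Filling n) (λ F → inversions F ≡ k)

-- Ballot number B(α,β) = (α-β+1)/(α+1) * binom(α+β, α)
-- (an integer when β ≤ α+1, the only case used; division is exact there)
B : ℕ → ℕ → ℕ
B α β = ((suc α ∸ β) * ((α + β) C α)) / suc α

Σ₁ : ℕ → (ℕ → ℕ) → ℕ
Σ₁ n f = sum (map (λ i → f (suc i)) (upTo n))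

-- Record a filling as the word w₁ … w₂ₙ with wₚ = true iff p lies in the top
-- row; its columns pair the c-th true with the c-th false.  Cutting the word
-- where #true − #false returns to 0 splits it into primitive factors; every
-- column lies inside one factor and has its smaller entry in the row of the
-- factor's first letter.  So a column is an inversion exactly when that row
-- changes at the next column (for the last column: when it is the bottom row),
-- and the inversion number is the number of changes in the sequence of first
-- letters followed by true.  Forgetting the first letters, a word with i factors
-- is a ballot path counted by B(n-1, n-i), while the first letters with k changes
-- are counted by C(i, k).  Hence |S_k| = Σᵢ B(n-1, n-i) C(i, k), the coefficient
-- of q^k in Σᵢ B(n-1, n-i) (1+q)^i; both closed forms of the ballot numbers come
-- from the factorial identity satisfied by their recurrence.

module Submission where

open import Defs
open import Data.Bool using (Bool; true; false; not; _xor_; if_then_else_)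
open import Data.Bool.Properties using (xor-assoc; xor-same; xor-identityʳ)
open import Data.Empty using (⊥-elim)
open import Data.Fin using (Fin)
import Data.Fin as Fin
open import Data.Fin.Properties using (+↔⊎; *↔×)
open import Data.List using (List; []; _∷_; _++_; [_]; length; map; zipWith; applyUpTo; upTo)
open import Data.List.Properties using (++-assoc; ++-identityʳ; length-++; map-∘; map-upTo)
open import Data.List.Relation.Unary.All as All using (All; []; _∷_)
open import Data.List.Relation.Unary.All.Properties using (++⁺)
import Data.List.Relation.Binary.Permutation.Propositional as ↭
open import Data.List.Relation.Binary.Permutation.Propositional using (_↭_; ↭-trans)
open import Data.List.Relation.Binary.Permutation.Propositional.Properties using (shift)
open import Data.Nat
open import Data.Nat.Properties
open import Data.Nat.Combinatorics using (_C_; k![n∸k]!∣n!; nCk≡nC[n∸k]; nCk+nC[k+1]≡[n+1]C[k+1])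
open import Data.Nat.Combinatorics.Specification using (nCk≡n!/k![n-k]!)
open import Data.Nat.DivMod using (m/n*n≡m; m*n/n≡m)
open import Data.Nat.ListAction using (sum)
open import Data.Nat.Solver using (module +-*-Solver)
open import Data.Product using (Σ; ∃; _×_; _,_; proj₁; proj₂)
open import Data.Product.Function.NonDependent.Propositional using (_×-↔_)
open import Data.Sum using (_⊎_; inj₁; inj₂)
open import Data.Sum.Function.Propositional using (_⊎-↔_)
open import Data.Unit using (⊤; tt)
open import Data.Vec using (Vec; []; _∷_; toList; lookup)
open import Data.Vec.Properties using (toList-injective; length-toList)
open import Data.Vec.Relation.Binary.Equality.Cast using (cast-is-id)
open import Function.Bundles using (_↔_; mk↔ₛ′; Inverse)
open import Function.Properties.Inverse using (↔-refl; ↔-sym; ↔-trans)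
open import Function.Related.Propositional using (≡⇒; module EquationalReasoning)
open import Relation.Binary.Definitions using (tri<; tri≈; tri>)
open import Relation.Binary.PropositionalEquality hiding ([_])
open import Relation.Nullary using (yes; no)
open import Relation.Nullary.Decidable using (recompute)

open +-*-Solver

Σ-≡ : ∀ {A : Set} {P : A → Set} → (∀ a (p q : P a) → p ≡ q) →
      (x y : Σ A P) → proj₁ x ≡ proj₁ y → x ≡ y
Σ-≡ irr (a , p) (.a , q) refl = cong (a ,_) (irr a p q)

bit : Bool → ℕ
bit true  = 1
bit false = 0

trues : List Bool → ℕ
trues []      = 0
trues (x ∷ w) = bit x + trues w

falses : List Bool → ℕ
falses []      = 0
falses (x ∷ w) = bit (not x) + falses w

-- Ballot numbers

-- Paths from height i to 0 by rises (true) and falls (false), m of them rises,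
-- positive before the end.
data BallotPath : ℕ → ℕ → List Bool → Set where
  done : BallotPath 0 0 []
  down : ∀ {m i v} → BallotPath m i v → BallotPath m (suc i) (false ∷ v)
  up   : ∀ {m i v} → BallotPath m (suc (suc i)) v → BallotPath (suc m) (suc i) (true ∷ v)

BallotPaths : ℕ → ℕ → Set
BallotPaths m i = Σ (List Bool) (BallotPath m i)

ballotPath-irrelevant : ∀ {m i v} (p q : BallotPath m i v) → p ≡ q
ballotPath-irrelevant done     done     = refl
ballotPath-irrelevant (down p) (down q) = cong down (ballotPath-irrelevant p q)
ballotPath-irrelevant (up p)   (up q)   = cong up (ballotPath-irrelevant p q)

ballotPath-trues : ∀ {m i v} → BallotPath m i v → trues v ≡ m
ballotPath-trues done     = refl
ballotPath-trues (down p) = ballotPath-trues p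
ballotPath-trues (up p)   = cong suc (ballotPath-trues p)

ballotPath-length : ∀ {m i v} → BallotPath m i v → length v ≡ m + (m + i)
ballotPath-length done = refl
ballotPath-length {m} {suc i} (down p) =
  trans (cong suc (ballotPath-length p))
        (solve 2 (λ m i → con 1 :+ (m :+ (m :+ i)) := m :+ (m :+ (con 1 :+ i))) refl m i)
ballotPath-length {suc m} {suc i} (up p) =
  trans (cong suc (ballotPath-length p))
        (solve 2 (λ m i → con 1 :+ (m :+ (m :+ (con 2 :+ i))) := (con 1 :+ m) :+ ((con 1 :+ m) :+ (con 1 :+ i))) refl m i)

ballotPath-height-zero : ∀ {m v} → BallotPath m 0 v → m ≡ 0 × v ≡ []
ballotPath-height-zero done = refl , refl

ballotCount : ℕ → ℕ → ℕ
ballotCount zero    zero    = 1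
ballotCount (suc m) zero    = 0
ballotCount zero    (suc i) = ballotCount zero i
ballotCount (suc m) (suc i) = ballotCount (suc m) i + ballotCount m (suc (suc i))

Fin↔BallotPaths : ∀ m i → Fin (ballotCount m i) ↔ BallotPaths m i
Fin↔BallotPaths zero zero =
  mk↔ₛ′ (λ _ → [] , done) (λ _ → Fin.zero) (λ { ([] , done) → refl }) (λ { Fin.zero → refl ; (Fin.suc ()) })
Fin↔BallotPaths (suc m) zero = mk↔ₛ′ (λ ()) (λ { (_ , ()) }) (λ { (_ , ()) }) (λ ())
Fin↔BallotPaths zero (suc i) = ↔-trans (Fin↔BallotPaths zero i)
  (mk↔ₛ′ (λ { (v , p) → false ∷ v , down p }) (λ { (false ∷ v , down p) → v , p })
         (λ { (false ∷ v , down p) → refl }) (λ _ → refl))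
Fin↔BallotPaths (suc m) (suc i) =
  ↔-trans +↔⊎ (↔-trans (Fin↔BallotPaths (suc m) i ⊎-↔ Fin↔BallotPaths m (suc (suc i)))
    (mk↔ₛ′ extend split (λ { (false ∷ v , down p) → refl ; (true ∷ v , up p) → refl })
                        (λ { (inj₁ _) → refl ; (inj₂ _) → refl })))
  where
  extend : BallotPaths (suc m) i ⊎ BallotPaths m (suc (suc i)) → BallotPaths (suc m) (suc i)
  extend (inj₁ (v , p)) = false ∷ v , down p
  extend (inj₂ (v , p)) = true ∷ v , up p
  split : BallotPaths (suc m) (suc i) → BallotPaths (suc m) i ⊎ BallotPaths m (suc (suc i))
  split (false ∷ v , down p) = inj₁ (v , p)
  split (true ∷ v , up p)    = inj₂ (v , p)

ballotCount-zero : ∀ i → ballotCount 0 i ≡ 1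
ballotCount-zero zero    = refl
ballotCount-zero (suc i) = ballotCount-zero i

ballotCount-factorial : ∀ m j → m ! * (suc (m + j)) ! * ballotCount m (suc j) ≡ suc j * (m + m + j) !
ballotCount-factorial zero j =
  trans (cong (1 * (suc j) ! *_) (ballotCount-zero j))
        (solve 2 (λ j a → con 1 :* ((con 1 :+ j) :* a) :* con 1 := (con 1 :+ j) :* a) refl j (j !))
ballotCount-factorial (suc m) zero = step (ballotCount-factorial m 1)
  where
  open ≡-Reasoning
  c = ballotCount m 2
  step : m ! * (suc (m + 1)) ! * c ≡ 2 * (m + m + 1) ! →
         (suc m) ! * (suc (suc m + 0)) ! * (0 + c) ≡ 1 * (suc m + suc m + 0) !
  step IH = begin
      (suc m) ! * (suc (suc m + 0)) ! * c
    ≡⟨ cong (λ z → (suc m) ! * (suc z) ! * c) (+-identityʳ (suc m)) ⟩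
      (suc m * m !) * (suc (suc m)) ! * c
    ≡⟨ solve 4 (λ m a b c → ((con 1 :+ m) :* a) :* b :* c := (con 1 :+ m) :* (a :* b :* c))
               refl m (m !) ((suc (suc m)) !) c ⟩
      suc m * (m ! * (suc (suc m)) ! * c)
    ≡⟨ cong (suc m *_) ih ⟩
      suc m * (2 * (suc (m + m)) !)
    ≡⟨ solve 2 (λ m x → (con 1 :+ m) :* (con 2 :* x) := con 1 :* ((con 2 :+ (m :+ m)) :* x))
               refl m ((suc (m + m)) !) ⟩
      1 * (suc (suc (m + m))) !
    ≡⟨ cong (λ z → 1 * z !) (sym (trans (+-identityʳ _) (cong suc (+-suc m m)))) ⟩
      1 * (suc m + suc m + 0) !
    ∎
    where
    ih : m ! * (suc (suc m)) ! * c ≡ 2 * (suc (m + m)) !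
    ih = subst₂ (λ u v → m ! * (suc u) ! * c ≡ 2 * v !) (+-comm m 1) (+-comm (m + m) 1) IH
ballotCount-factorial (suc m) (suc j) =
  step (ballotCount-factorial (suc m) j) (ballotCount-factorial m (suc (suc j)))
  where
  open ≡-Reasoning
  k = m + m + j
  l = m + j
  y = (suc (suc l)) !
  x = (suc (suc k)) !
  c₁ = ballotCount (suc m) (suc j)
  c₂ = ballotCount m (suc (suc (suc j)))
  k+2≡ : suc m + suc m + j ≡ suc (suc k)
  k+2≡ = cong suc (cong (_+ j) (+-suc m m))
  k+3≡ : suc m + suc m + suc j ≡ suc (suc (suc k))
  k+3≡ = trans (+-suc (suc m + suc m) j) (cong suc k+2≡)
  step : (suc m) ! * (suc (suc m + j)) ! * c₁ ≡ suc j * (suc m + suc m + j) ! →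
         m ! * (suc (m + suc (suc j))) ! * c₂ ≡ suc (suc (suc j)) * (m + m + suc (suc j)) ! →
         (suc m) ! * (suc (suc m + suc j)) ! * (c₁ + c₂) ≡ suc (suc j) * (suc m + suc m + suc j) !
  step IH₁ IH₂ = begin
      (suc m) ! * (suc (suc m + suc j)) ! * (c₁ + c₂)
    ≡⟨ cong (λ z → (suc m) ! * z ! * (c₁ + c₂)) (cong (λ z → suc (suc z)) (+-suc m j)) ⟩
      (suc m * m !) * (suc (suc (suc l)) * y) * (c₁ + c₂)
    ≡⟨ solve 6 (λ m l a y c₁ c₂ → ((con 1 :+ m) :* a) :* ((con 3 :+ l) :* y) :* (c₁ :+ c₂)
          := (con 3 :+ l) :* (((con 1 :+ m) :* a) :* y :* c₁) :+ (con 1 :+ m) :* (a :* ((con 3 :+ l) :* y) :* c₂))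
          refl m l (m !) y c₁ c₂ ⟩
      suc (suc (suc l)) * ((suc m * m !) * y * c₁) + suc m * (m ! * (suc (suc (suc l)) * y) * c₂)
    ≡⟨ cong₂ (λ u v → suc (suc (suc l)) * u + suc m * v) ih₁ ih₂ ⟩
      suc (suc (suc l)) * (suc j * x) + suc m * (suc (suc (suc j)) * x)
    ≡⟨ solve 3 (λ m j x → (con 3 :+ (m :+ j)) :* ((con 1 :+ j) :* x) :+ (con 1 :+ m) :* ((con 3 :+ j) :* x)
          := (con 2 :+ j) :* ((con 3 :+ (m :+ m :+ j)) :* x)) refl m j x ⟩
      suc (suc j) * (suc (suc (suc k)) * x)
    ≡⟨ cong (λ z → suc (suc j) * z !) (sym k+3≡) ⟩
      suc (suc j) * (suc m + suc m + suc j) !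
    ∎
    where
    ih₁ : (suc m * m !) * y * c₁ ≡ suc j * x
    ih₁ = subst (λ u → (suc m * m !) * y * c₁ ≡ suc j * u !) k+2≡ IH₁
    ih₂ : m ! * ((suc (suc (suc l))) * y) * c₂ ≡ suc (suc (suc j)) * x
    ih₂ = subst₂ (λ u v → m ! * (suc u) ! * c₂ ≡ suc (suc (suc j)) * v !)
                 (trans (+-suc m (suc j)) (cong suc (+-suc m j)))
                 (trans (+-suc (m + m) (suc j)) (cong suc (+-suc (m + m) j)))
                 IH₂

binomial-factorial : ∀ n k → k ≤ n → (n C k) * (k ! * (n ∸ k) !) ≡ n !
binomial-factorial n k k≤n =
  trans (cong (_* (k ! * (n ∸ k) !)) (nCk≡n!/k![n-k]! k≤n))
        (m/n*n≡m {{k !* (n ∸ k) !≢0}} (k![n∸k]!∣n! k≤n))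

ballotCount-binomial : ∀ m j → ballotCount m (suc j) * suc (m + j) ≡ suc j * ((m + j + m) C (m + j))
ballotCount-binomial m j = *-cancelʳ-≡ _ _ ((m + j) ! * m !) {{(m + j) !* m !≢0}} (begin
    c * suc (m + j) * ((m + j) ! * m !)
  ≡⟨ solve 4 (λ c l x y → c :* (con 1 :+ l) :* (x :* y) := y :* ((con 1 :+ l) :* x) :* c)
             refl c (m + j) ((m + j) !) (m !) ⟩
    m ! * (suc (m + j)) ! * c
  ≡⟨ ballotCount-factorial m j ⟩
    suc j * (m + m + j) !
  ≡⟨ cong (suc j *_) (sym binomial≡) ⟩
    suc j * (b * ((m + j) ! * m !))
  ≡⟨ sym (*-assoc (suc j) b _) ⟩
    suc j * b * ((m + j) ! * m !)
  ∎)
  where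
  open ≡-Reasoning
  c = ballotCount m (suc j)
  b = (m + j + m) C (m + j)
  binomial≡ : b * ((m + j) ! * m !) ≡ (m + m + j) !
  binomial≡ = trans (cong (λ z → b * ((m + j) ! * z !)) (sym (m+n∸m≡n (m + j) m)))
             (trans (binomial-factorial (m + j + m) (m + j) (m≤m+n (m + j) m))
                    (cong _! (solve 2 (λ m j → m :+ j :+ m := m :+ m :+ j) refl m j)))

ballotCount-quotient : ∀ m i → (suc i * ((m + i + m) C (m + i))) / suc (m + i) ≡ ballotCount m (suc i)
ballotCount-quotient m i = trans (cong (_/ suc (m + i)) (sym (ballotCount-binomial m i)))
                                 (m*n/n≡m (ballotCount m (suc i)) (suc (m + i)))

B-ballotCount : ∀ m i → B (m + i) m ≡ ballotCount m (suc i)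
B-ballotCount m i = trans (cong (λ z → (z * ((m + i + m) C (m + i))) / suc (m + i)) numerator≡)
                          (ballotCount-quotient m i)
  where
  numerator≡ : suc (m + i) ∸ m ≡ suc i
  numerator≡ = trans (cong (_∸ m) (sym (+-suc m i))) (m+n∸m≡n m (suc i))

-- The paper's closed form (i/n)·C(2n-i-1, n-i) at n = m + i + 1 and i + 1.
closedForm-ballotCount : ∀ m i → let n = m + i in
  (suc i * ((suc n + suc n ∸ suc i ∸ 1) C (suc n ∸ suc i))) / suc n ≡ ballotCount m (suc i)
closedForm-ballotCount m i = trans (cong (λ z → (suc i * z) / suc (m + i)) binomial≡) (ballotCount-quotient m i)
  where
  open ≡-Reasoning
  top≡ : suc (m + i) + suc (m + i) ∸ suc i ∸ 1 ≡ m + i + m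
  top≡ = begin
      (m + i + suc (m + i)) ∸ i ∸ 1
    ≡⟨ cong (λ z → z ∸ i ∸ 1)
            (solve 2 (λ m i → m :+ i :+ (con 1 :+ (m :+ i)) := i :+ (con 1 :+ (m :+ i :+ m))) refl m i) ⟩
      (i + suc (m + i + m)) ∸ i ∸ 1
    ≡⟨ cong (_∸ 1) (m+n∸m≡n i (suc (m + i + m))) ⟩
      m + i + m
    ∎
  binomial≡ : (suc (m + i) + suc (m + i) ∸ suc i ∸ 1) C (suc (m + i) ∸ suc i) ≡ (m + i + m) C (m + i)
  binomial≡ = begin
      (suc (m + i) + suc (m + i) ∸ suc i ∸ 1) C (suc (m + i) ∸ suc i)
    ≡⟨ cong₂ _C_ top≡ (m+n∸n≡m m i) ⟩
      (m + i + m) C m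
    ≡⟨ nCk≡nC[n∸k] (m≤n+m m (m + i)) ⟩
      (m + i + m) C (m + i + m ∸ m)
    ≡⟨ cong ((m + i + m) C_) (m+n∸n≡m (m + i) m) ⟩
      (m + i + m) C (m + i)
    ∎

-- Words counted by number of changes

changes : List Bool → ℕ
changes []          = 0
changes (a ∷ [])    = 0
changes (a ∷ b ∷ w) = bit (a xor b) + changes (b ∷ w)

≡×≡-irrelevant : ∀ {a b c d : ℕ} (p q : a ≡ b × c ≡ d) → p ≡ q
≡×≡-irrelevant (p , q) (p′ , q′) = cong₂ _,_ (≡-irrelevant p p′) (≡-irrelevant q q′)

WordsWithTrues : ℕ → ℕ → Set
WordsWithTrues i k = Σ (List Bool) (λ d → length d ≡ i × trues d ≡ k)

Fin↔WordsWithTrues : ∀ i k → Fin (i C k) ↔ WordsWithTrues i k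
Fin↔WordsWithTrues zero zero =
  mk↔ₛ′ (λ _ → [] , refl , refl) (λ _ → Fin.zero) (λ { ([] , refl , refl) → refl }) (λ { Fin.zero → refl ; (Fin.suc ()) })
Fin↔WordsWithTrues zero (suc k) = mk↔ₛ′ (λ ()) (λ { ([] , _ , ()) }) (λ { ([] , _ , ()) }) (λ ())
Fin↔WordsWithTrues (suc i) zero = ↔-trans (Fin↔WordsWithTrues i zero)
  (mk↔ₛ′ (λ { (d , l , t) → false ∷ d , cong suc l , t }) shorten
         (λ { x@(false ∷ _ , _ , _) → Σ-≡ (λ _ → ≡×≡-irrelevant) _ x refl ; ([] , () , _) ; (true ∷ _ , _ , ()) })
         (λ x → Σ-≡ (λ _ → ≡×≡-irrelevant) _ x refl))
  where
  shorten : WordsWithTrues (suc i) zero → WordsWithTrues i zero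
  shorten (false ∷ d , l , t) = d , suc-injective l , t
  shorten ([] , () , _)
  shorten (true ∷ d , _ , ())
Fin↔WordsWithTrues (suc i) (suc k) =
  ↔-trans (≡⇒ (cong Fin (sym (nCk+nC[k+1]≡[n+1]C[k+1] i k))))
    (↔-trans +↔⊎ (↔-trans (Fin↔WordsWithTrues i k ⊎-↔ Fin↔WordsWithTrues i (suc k))
      (mk↔ₛ′ extend split
        (λ { ([] , () , _) ; x@(true ∷ _ , _ , _) → Σ-≡ (λ _ → ≡×≡-irrelevant) _ x refl
           ; x@(false ∷ _ , _ , _) → Σ-≡ (λ _ → ≡×≡-irrelevant) _ x refl })
        (λ { (inj₁ x) → cong inj₁ (Σ-≡ (λ _ → ≡×≡-irrelevant) _ x refl)
           ; (inj₂ x) → cong inj₂ (Σ-≡ (λ _ → ≡×≡-irrelevant) _ x refl) }))))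
  where
  extend : WordsWithTrues i k ⊎ WordsWithTrues i (suc k) → WordsWithTrues (suc i) (suc k)
  extend (inj₁ (d , l , t)) = true ∷ d , cong suc l , cong suc t
  extend (inj₂ (d , l , t)) = false ∷ d , cong suc l , t
  split : WordsWithTrues (suc i) (suc k) → WordsWithTrues i k ⊎ WordsWithTrues i (suc k)
  split ([] , () , _)
  split (true ∷ d , l , t)  = inj₁ (d , suc-injective l , suc-injective t)
  split (false ∷ d , l , t) = inj₂ (d , suc-injective l , t)

head-or-true : List Bool → Bool
head-or-true []      = true
head-or-true (x ∷ _) = x

-- Entry i of differences s tells whether s ++ [ true ] changes between positions i and i + 1.
differences : List Bool → List Bool
differences []      = []
differences (x ∷ s) = (x xor head-or-true s) ∷ differences s

integrate : List Bool → List Bool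
integrate []       = []
integrate (d ∷ ds) = (d xor head-or-true (integrate ds)) ∷ integrate ds

xor-cancelʳ : ∀ a b → (a xor b) xor b ≡ a
xor-cancelʳ a b = trans (xor-assoc a b b) (trans (cong (a xor_) (xor-same b)) (xor-identityʳ a))

integrate-differences : ∀ s → integrate (differences s) ≡ s
integrate-differences []      = refl
integrate-differences (x ∷ s) rewrite integrate-differences s = cong (_∷ s) (xor-cancelʳ x (head-or-true s))

differences-integrate : ∀ d → differences (integrate d) ≡ d
differences-integrate []       = refl
differences-integrate (d ∷ ds) rewrite differences-integrate ds =
  cong (_∷ ds) (xor-cancelʳ d (head-or-true (integrate ds)))

length-differences : ∀ s → length (differences s) ≡ length s
length-differences []      = refl
length-differences (x ∷ s) = cong suc (length-differences s)

length-integrate : ∀ d → length (integrate d) ≡ length d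
length-integrate []      = refl
length-integrate (x ∷ d) = cong suc (length-integrate d)

trues-differences : ∀ s → trues (differences s) ≡ changes (s ++ [ true ])
trues-differences []          = refl
trues-differences (x ∷ [])    = refl
trues-differences (x ∷ y ∷ s) = cong (bit (x xor y) +_) (trues-differences (y ∷ s))

WordsWithChanges : ℕ → ℕ → Set
WordsWithChanges i k = Σ (List Bool) (λ s → length s ≡ i × changes (s ++ [ true ]) ≡ k)

Fin↔WordsWithChanges : ∀ i k → Fin (i C k) ↔ WordsWithChanges i k
Fin↔WordsWithChanges i k = ↔-trans (Fin↔WordsWithTrues i k) (mk↔ₛ′ to from
  (λ x → Σ-≡ (λ _ → ≡×≡-irrelevant) _ x (integrate-differences (proj₁ x)))
  (λ x → Σ-≡ (λ _ → ≡×≡-irrelevant) _ x (differences-integrate (proj₁ x))))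
  where
  to : WordsWithTrues i k → WordsWithChanges i k
  to (d , l , t) = integrate d , trans (length-integrate d) l ,
    trans (sym (trues-differences (integrate d))) (trans (cong trues (differences-integrate d)) t)
  from : WordsWithChanges i k → WordsWithTrues i k
  from (s , l , c) = differences s , trans (length-differences s) l , trans (trues-differences s) c

Σ< : ℕ → (ℕ → Set) → Set
Σ< n A = Σ ℕ (λ j → j < n × A j)

Σ<-suc : ∀ n A → (A 0 ⊎ Σ< n (λ j → A (suc j))) ↔ Σ< (suc n) A
Σ<-suc n A = mk↔ₛ′ to from
  (λ { (zero , lt , x) → cong (λ z → 0 , z , x) (≤-irrelevant _ _)
     ; (suc j , lt , y) → cong (λ z → suc j , z , y) (≤-irrelevant _ _) })
  (λ { (inj₁ x) → refl ; (inj₂ _) → refl })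
  where
  to : A 0 ⊎ Σ< n (λ j → A (suc j)) → Σ< (suc n) A
  to (inj₁ x)            = 0 , s≤s z≤n , x
  to (inj₂ (j , lt , y)) = suc j , s≤s lt , y
  from : Σ< (suc n) A → A 0 ⊎ Σ< n (λ j → A (suc j))
  from (zero , lt , x)  = inj₁ x
  from (suc j , lt , y) = inj₂ (j , s≤s⁻¹ lt , y)

Fin-sum↔Σ< : ∀ (g h : ℕ → ℕ) n → Fin (sum (map g (applyUpTo h n))) ↔ Σ< n (λ j → Fin (g (h j)))
Fin-sum↔Σ< g h zero    = mk↔ₛ′ (λ ()) (λ { (_ , () , _) }) (λ { (_ , () , _) }) (λ ())
Fin-sum↔Σ< g h (suc n) =
  ↔-trans +↔⊎ (↔-trans (↔-refl ⊎-↔ Fin-sum↔Σ< g (λ x → h (suc x)) n) (Σ<-suc n (λ j → Fin (g (h j)))))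

Σ<-cong : ∀ n {A A′ : ℕ → Set} → (∀ {j} → j < n → A j ↔ A′ j) → Σ< n A ↔ Σ< n A′
Σ<-cong n {A} {A′} f = mk↔ₛ′ to from
  (λ (j , lt , x) → cong (λ z → j , lt , z) (Inverse.strictlyInverseˡ (f lt) x))
  (λ (j , lt , x) → cong (λ z → j , lt , z) (Inverse.strictlyInverseʳ (f lt) x))
  where
  to : Σ< n A → Σ< n A′
  to (j , lt , x) = j , lt , Inverse.to (f lt) x
  from : Σ< n A′ → Σ< n A
  from (j , lt , x) = j , lt , Inverse.from (f lt) x

sum-cong : ∀ (f g h : ℕ → ℕ) n → (∀ {j} → j < n → f (h j) ≡ g (h j)) →
           sum (map f (applyUpTo h n)) ≡ sum (map g (applyUpTo h n))
sum-cong f g h zero    e = refl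
sum-cong f g h (suc n) e = cong₂ _+_ (e (s≤s z≤n)) (sum-cong f g (λ x → h (suc x)) n (λ lt → e (s≤s lt)))

-- Decomposition of balanced words into primitive factors

same : Bool → Bool → Bool
same true  true  = true
same false false = true
same _     _     = false

-- Read a word with current height h in the current primitive factor, whose
-- first letter is σ.  A letter equal to σ rises, any other falls; at height 0
-- the next letter opens a new factor.  shape records the rises and falls
-- after the first letter of each factor, signs the first letters.
shape : ℕ → Bool → List Bool → List Bool
shape zero    σ []      = []
shape zero    σ (x ∷ w) = shape 1 x w
shape (suc h) σ []      = []
shape (suc h) σ (x ∷ w) = if same x σ then true ∷ shape (suc (suc h)) σ w else false ∷ shape h σ w

signs : ℕ → Bool → List Bool → List Bool
signs zero    σ []      = []
signs zero    σ (x ∷ w) = x ∷ signs 1 x w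
signs (suc h) σ []      = []
signs (suc h) σ (x ∷ w) = if same x σ then signs (suc (suc h)) σ w else signs h σ w

finalHeight : ℕ → Bool → List Bool → ℕ
finalHeight zero    σ []      = 0
finalHeight zero    σ (x ∷ w) = finalHeight 1 x w
finalHeight (suc h) σ []      = suc h
finalHeight (suc h) σ (x ∷ w) = if same x σ then finalHeight (suc (suc h)) σ w else finalHeight h σ w

finalSign : ℕ → Bool → List Bool → Bool
finalSign zero    σ []      = σ
finalSign zero    σ (x ∷ w) = finalSign 1 x w
finalSign (suc h) σ []      = σ
finalSign (suc h) σ (x ∷ w) = if same x σ then finalSign (suc (suc h)) σ w else finalSign h σ w

-- Every fall closes a column whose smaller entry lies in the row of σ.
columnSigns : ℕ → Bool → List Bool → List Bool
columnSigns zero    σ []      = []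
columnSigns zero    σ (x ∷ w) = columnSigns 1 x w
columnSigns (suc h) σ []      = []
columnSigns (suc h) σ (x ∷ w) = if same x σ then columnSigns (suc (suc h)) σ w else σ ∷ columnSigns h σ w

assemble : ℕ → Bool → List Bool → List Bool → List Bool
assemble zero    σ v            []       = []
assemble zero    σ v            (s ∷ ss) = s ∷ assemble 1 s v ss
assemble (suc h) σ []           ss       = []
assemble (suc h) σ (true ∷ v)   ss       = σ ∷ assemble (suc (suc h)) σ v ss
assemble (suc h) σ (false ∷ v)  ss       = not σ ∷ assemble h σ v ss

assemble-shape-signs : ∀ h σ w → finalHeight h σ w ≡ 0 → assemble h σ (shape h σ w) (signs h σ w) ≡ w
assemble-shape-signs zero    σ     []          e = refl
assemble-shape-signs zero    σ     (x ∷ w)     e = cong (x ∷_) (assemble-shape-signs 1 x w e)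
assemble-shape-signs (suc h) σ     []          ()
assemble-shape-signs (suc h) true  (true ∷ w)  e = cong (true ∷_) (assemble-shape-signs (suc (suc h)) true w e)
assemble-shape-signs (suc h) true  (false ∷ w) e = cong (false ∷_) (assemble-shape-signs h true w e)
assemble-shape-signs (suc h) false (true ∷ w)  e = cong (true ∷_) (assemble-shape-signs h false w e)
assemble-shape-signs (suc h) false (false ∷ w) e = cong (false ∷_) (assemble-shape-signs (suc (suc h)) false w e)

shape-assemble : ∀ {m} h σ v ss → BallotPath m (h + length ss) v → shape h σ (assemble h σ v ss) ≡ v
shape-assemble zero    σ     v           []       p        = sym (proj₂ (ballotPath-height-zero p))
shape-assemble zero    σ     v           (s ∷ ss) p        = shape-assemble 1 s v ss p
shape-assemble (suc h) σ     []          ss       ()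
shape-assemble (suc h) true  (true ∷ v)  ss       (up p)   = cong (true ∷_) (shape-assemble (suc (suc h)) true v ss p)
shape-assemble (suc h) false (true ∷ v)  ss       (up p)   = cong (true ∷_) (shape-assemble (suc (suc h)) false v ss p)
shape-assemble (suc h) true  (false ∷ v) ss       (down p) = cong (false ∷_) (shape-assemble h true v ss p)
shape-assemble (suc h) false (false ∷ v) ss       (down p) = cong (false ∷_) (shape-assemble h false v ss p)

signs-assemble : ∀ {m} h σ v ss → BallotPath m (h + length ss) v → signs h σ (assemble h σ v ss) ≡ ss
signs-assemble zero    σ     v           []       p        = refl
signs-assemble zero    σ     v           (s ∷ ss) p        = cong (s ∷_) (signs-assemble 1 s v ss p)
signs-assemble (suc h) σ     []          ss       ()
signs-assemble (suc h) true  (true ∷ v)  ss       (up p)   = signs-assemble (suc (suc h)) true v ss p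
signs-assemble (suc h) false (true ∷ v)  ss       (up p)   = signs-assemble (suc (suc h)) false v ss p
signs-assemble (suc h) true  (false ∷ v) ss       (down p) = signs-assemble h true v ss p
signs-assemble (suc h) false (false ∷ v) ss       (down p) = signs-assemble h false v ss p

finalHeight-assemble : ∀ {m} h σ v ss → BallotPath m (h + length ss) v → finalHeight h σ (assemble h σ v ss) ≡ 0
finalHeight-assemble zero    σ     v           []       p        = refl
finalHeight-assemble zero    σ     v           (s ∷ ss) p        = finalHeight-assemble 1 s v ss p
finalHeight-assemble (suc h) σ     []          ss       ()
finalHeight-assemble (suc h) true  (true ∷ v)  ss       (up p)   = finalHeight-assemble (suc (suc h)) true v ss p
finalHeight-assemble (suc h) false (true ∷ v)  ss       (up p)   = finalHeight-assemble (suc (suc h)) false v ss p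
finalHeight-assemble (suc h) true  (false ∷ v) ss       (down p) = finalHeight-assemble h true v ss p
finalHeight-assemble (suc h) false (false ∷ v) ss       (down p) = finalHeight-assemble h false v ss p

-- Opening a factor moves one unit from the count of factors still to come to the height.
shape-ballotPath : ∀ h σ w → finalHeight h σ w ≡ 0 →
                   BallotPath (trues (shape h σ w)) (h + length (signs h σ w)) (shape h σ w)
shape-ballotPath zero    σ     []          e = done
shape-ballotPath zero    σ     (x ∷ w)     e = shape-ballotPath 1 x w e
shape-ballotPath (suc h) σ     []          ()
shape-ballotPath (suc h) true  (true ∷ w)  e = up (shape-ballotPath (suc (suc h)) true w e)
shape-ballotPath (suc h) true  (false ∷ w) e = down (shape-ballotPath h true w e)
shape-ballotPath (suc h) false (true ∷ w)  e = down (shape-ballotPath h false w e)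
shape-ballotPath (suc h) false (false ∷ w) e = up (shape-ballotPath (suc (suc h)) false w e)

length-shape-signs : ∀ h σ w → length w ≡ length (shape h σ w) + length (signs h σ w)
length-shape-signs zero    σ     []          = refl
length-shape-signs zero    σ     (x ∷ w)     = trans (cong suc (length-shape-signs 1 x w)) (sym (+-suc _ _))
length-shape-signs (suc h) σ     []          = refl
length-shape-signs (suc h) true  (true ∷ w)  = cong suc (length-shape-signs (suc (suc h)) true w)
length-shape-signs (suc h) true  (false ∷ w) = cong suc (length-shape-signs h true w)
length-shape-signs (suc h) false (true ∷ w)  = cong suc (length-shape-signs h false w)
length-shape-signs (suc h) false (false ∷ w) = cong suc (length-shape-signs (suc (suc h)) false w)

onTrue onFalse : ℕ → Bool → ℕ
onTrue  h true  = h
onTrue  h false = 0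
onFalse h true  = 0
onFalse h false = h

-- Inside a factor of sign σ the height is the excess of σ's over the other letter.
trues-falses-balance : ∀ h σ w →
  onTrue h σ + trues w + onFalse (finalHeight h σ w) (finalSign h σ w)
  ≡ onFalse h σ + falses w + onTrue (finalHeight h σ w) (finalSign h σ w)
trues-falses-balance zero    true  []          = refl
trues-falses-balance zero    false []          = refl
trues-falses-balance zero    true  (true ∷ w)  = trues-falses-balance 1 true w
trues-falses-balance zero    true  (false ∷ w) = trues-falses-balance 1 false w
trues-falses-balance zero    false (true ∷ w)  = trues-falses-balance 1 true w
trues-falses-balance zero    false (false ∷ w) = trues-falses-balance 1 false w
trues-falses-balance (suc h) true  []          = trans (+-identityʳ _) (+-identityʳ _)
trues-falses-balance (suc h) false []          = sym (trans (+-identityʳ _) (+-identityʳ _))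
trues-falses-balance (suc h) true  (true ∷ w)  =
  trans (cong (_+ onFalse (finalHeight (suc (suc h)) true w) (finalSign (suc (suc h)) true w)) (+-suc (suc h) (trues w)))
        (trues-falses-balance (suc (suc h)) true w)
trues-falses-balance (suc h) true  (false ∷ w) = cong suc (trues-falses-balance h true w)
trues-falses-balance (suc h) false (true ∷ w)  = cong suc (trues-falses-balance h false w)
trues-falses-balance (suc h) false (false ∷ w) =
  trans (trues-falses-balance (suc (suc h)) false w)
        (cong (_+ onTrue (finalHeight (suc (suc h)) false w) (finalSign (suc (suc h)) false w))
              (sym (+-suc (suc h) (falses w))))

balanced⇒finalHeight≡0 : ∀ w → trues w ≡ falses w → finalHeight 0 true w ≡ 0
balanced⇒finalHeight≡0 w e with trues-falses-balance 0 true w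
... | b with finalSign 0 true w
...   | true  = sym (+-cancelˡ-≡ (trues w) _ _ (trans b (cong (_+ finalHeight 0 true w) (sym e))))
...   | false = +-cancelˡ-≡ (trues w) _ _ (trans b (cong (_+ 0) (sym e)))

finalHeight≡0⇒balanced : ∀ w → finalHeight 0 true w ≡ 0 → trues w ≡ falses w
finalHeight≡0⇒balanced w e with trues-falses-balance 0 true w
... | b with finalSign 0 true w | finalHeight 0 true w
...   | true  | zero = trans (sym (+-identityʳ _)) (trans b (+-identityʳ _))
...   | false | zero = trans (sym (+-identityʳ _)) (trans b (+-identityʳ _))

trues+falses : ∀ w → trues w + falses w ≡ length w
trues+falses []          = refl
trues+falses (true ∷ w)  = cong suc (trues+falses w)
trues+falses (false ∷ w) = trans (+-suc _ _) (cong suc (trues+falses w))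

columnSigns-head : ∀ h σ w → finalHeight (suc h) σ w ≡ 0 → ∃ λ r → columnSigns (suc h) σ w ≡ σ ∷ r
columnSigns-head h σ     []          ()
columnSigns-head h true  (true ∷ w)  e = columnSigns-head (suc h) true w e
columnSigns-head h true  (false ∷ w) e = columnSigns h true w , refl
columnSigns-head h false (true ∷ w)  e = columnSigns h false w , refl
columnSigns-head h false (false ∷ w) e = columnSigns-head (suc h) false w e

changes-repeat : ∀ x l → changes (x ∷ x ∷ l) ≡ changes (x ∷ l)
changes-repeat x l = cong (λ b → bit b + changes (x ∷ l)) (xor-same x)

-- All columns of a factor share its sign, and repeating a letter adds no change.
changes-columnSigns : ∀ h σ w → finalHeight h σ w ≡ 0 →
  changes (σ ∷ columnSigns h σ w ++ [ true ]) ≡ changes (σ ∷ signs h σ w ++ [ true ])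
changes-columnSigns zero σ [] e = refl
changes-columnSigns zero σ (x ∷ w) e with columnSigns-head 0 x w e
... | r , eq = begin
    changes (σ ∷ columnSigns 1 x w ++ [ true ])
  ≡⟨ cong (λ z → changes (σ ∷ z ++ [ true ])) eq ⟩
    bit (σ xor x) + changes (x ∷ r ++ [ true ])
  ≡⟨ cong (bit (σ xor x) +_) (sym (changes-repeat x (r ++ [ true ]))) ⟩
    bit (σ xor x) + changes (x ∷ x ∷ r ++ [ true ])
  ≡⟨ cong (λ z → bit (σ xor x) + changes (x ∷ z ++ [ true ])) (sym eq) ⟩
    bit (σ xor x) + changes (x ∷ columnSigns 1 x w ++ [ true ])
  ≡⟨ cong (bit (σ xor x) +_) (changes-columnSigns 1 x w e) ⟩
    changes (σ ∷ x ∷ signs 1 x w ++ [ true ])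
  ∎
  where open ≡-Reasoning
changes-columnSigns (suc h) σ     []          ()
changes-columnSigns (suc h) true  (true ∷ w)  e = changes-columnSigns (suc (suc h)) true w e
changes-columnSigns (suc h) true  (false ∷ w) e = changes-columnSigns h true w e
changes-columnSigns (suc h) false (true ∷ w)  e = changes-columnSigns h false w e
changes-columnSigns (suc h) false (false ∷ w) e = changes-columnSigns (suc (suc h)) false w e

changes-columnSigns₀ : ∀ w → finalHeight 0 true w ≡ 0 →
  changes (columnSigns 0 true w ++ [ true ]) ≡ changes (signs 0 true w ++ [ true ])
changes-columnSigns₀ []      e = refl
changes-columnSigns₀ (x ∷ w) e with columnSigns-head 0 x w e
... | r , eq = begin
    changes (columnSigns 1 x w ++ [ true ])
  ≡⟨ cong (λ z → changes (z ++ [ true ])) eq ⟩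
    changes (x ∷ r ++ [ true ])
  ≡⟨ sym (changes-repeat x (r ++ [ true ])) ⟩
    changes (x ∷ x ∷ r ++ [ true ])
  ≡⟨ cong (λ z → changes (x ∷ z ++ [ true ])) (sym eq) ⟩
    changes (x ∷ columnSigns 1 x w ++ [ true ])
  ≡⟨ changes-columnSigns 1 x w e ⟩
    changes (x ∷ signs 1 x w ++ [ true ])
  ∎
  where open ≡-Reasoning

IsBalanced : ℕ → ℕ → List Bool → Set
IsBalanced n k w = (trues w ≡ n × falses w ≡ n) × changes (columnSigns 0 true w ++ [ true ]) ≡ k

isBalanced-irrelevant : ∀ {n k} w (p q : IsBalanced n k w) → p ≡ q
isBalanced-irrelevant w (p , c) (p′ , c′) = cong₂ _,_ (≡×≡-irrelevant p p′) (≡-irrelevant c c′)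

BalancedWords : ℕ → ℕ → Set
BalancedWords n k = Σ (List Bool) (IsBalanced n k)

IsDecomposition : ℕ → ℕ → ℕ × List Bool × List Bool → Set
IsDecomposition n k (m , v , s) = BallotPath m (length s) v × m + length s ≡ n × changes (s ++ [ true ]) ≡ k

isDecomposition-irrelevant : ∀ {n k} x (p q : IsDecomposition n k x) → p ≡ q
isDecomposition-irrelevant _ (p , e , c) (p′ , e′ , c′) =
  cong₂ _,_ (ballotPath-irrelevant p p′) (cong₂ _,_ (≡-irrelevant e e′) (≡-irrelevant c c′))

Decompositions : ℕ → ℕ → Set
Decompositions n k = Σ (ℕ × List Bool × List Bool) (IsDecomposition n k)

double-injective : ∀ a b → a + a ≡ b + b → a ≡ b
double-injective zero    zero    e = refl
double-injective (suc a) (suc b) e =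
  cong suc (double-injective a b (suc-injective (trans (sym (+-suc a a)) (trans (suc-injective e) (+-suc b b)))))

length-decomposed : ∀ w → finalHeight 0 true w ≡ 0 → let l = trues (shape 0 true w) + length (signs 0 true w) in
                    length w ≡ l + l
length-decomposed w h≡0 = begin
    length w
  ≡⟨ length-shape-signs 0 true w ⟩
    length v + length s
  ≡⟨ cong (_+ length s) (ballotPath-length (shape-ballotPath 0 true w h≡0)) ⟩
    trues v + (trues v + length s) + length s
  ≡⟨ solve 2 (λ m l → m :+ (m :+ l) :+ l := (m :+ l) :+ (m :+ l)) refl (trues v) (length s) ⟩
    (trues v + length s) + (trues v + length s)
  ∎
  where
  open ≡-Reasoning
  v = shape 0 true w
  s = signs 0 true w

BalancedWords↔Decompositions : ∀ n k → BalancedWords n k ↔ Decompositions n k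
BalancedWords↔Decompositions n k = mk↔ₛ′ decompose compose
  (λ x@((m , v , s) , p , _ , _) → let v≡ = shape-assemble 0 true v s p in
     Σ-≡ isDecomposition-irrelevant _ x
       (cong₂ _,_ (trans (cong trues v≡) (ballotPath-trues p)) (cong₂ _,_ v≡ (signs-assemble 0 true v s p))))
  (λ x@(w , (t , f) , _) → Σ-≡ isBalanced-irrelevant _ x
     (assemble-shape-signs 0 true w (balanced⇒finalHeight≡0 w (trans t (sym f)))))
  where
  decompose : BalancedWords n k → Decompositions n k
  decompose (w , (t , f) , c) =
    (trues (shape 0 true w) , shape 0 true w , signs 0 true w) , shape-ballotPath 0 true w h≡0 ,
    double-injective _ _ (trans (sym (length-decomposed w h≡0)) (trans (sym (trues+falses w)) (cong₂ _+_ t f))) ,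
    trans (sym (changes-columnSigns₀ w h≡0)) c
    where
    h≡0 : finalHeight 0 true w ≡ 0
    h≡0 = balanced⇒finalHeight≡0 w (trans t (sym f))
  compose : Decompositions n k → BalancedWords n k
  compose ((m , v , s) , p , e , c) = w , (t≡n , trans (sym t≡f) t≡n) ,
    trans (changes-columnSigns₀ w h≡0) (trans (cong (λ z → changes (z ++ [ true ])) s≡) c)
    where
    w = assemble 0 true v s
    h≡0 : finalHeight 0 true w ≡ 0
    h≡0 = finalHeight-assemble 0 true v s p
    s≡ : signs 0 true w ≡ s
    s≡ = signs-assemble 0 true v s p
    t≡f : trues w ≡ falses w
    t≡f = finalHeight≡0⇒balanced w h≡0
    t≡n : trues w ≡ n
    t≡n = double-injective _ _ (begin
        trues w + trues w
      ≡⟨ cong (trues w +_) t≡f ⟩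
        trues w + falses w
      ≡⟨ trues+falses w ⟩
        length w
      ≡⟨ length-decomposed w h≡0 ⟩
        (trues (shape 0 true w) + length (signs 0 true w)) + (trues (shape 0 true w) + length (signs 0 true w))
      ≡⟨ cong (λ l → l + l) (cong₂ _+_ (trans (cong trues (shape-assemble 0 true v s p)) (ballotPath-trues p)) (cong length s≡)) ⟩
        (m + length s) + (m + length s)
      ≡⟨ cong₂ _+_ e e ⟩
        n + n
      ∎)
      where open ≡-Reasoning

Decompositions↔Σ< : ∀ n k →
  Decompositions (suc n) k ↔ Σ< (suc n) (λ j → BallotPaths (n ∸ j) (suc j) × WordsWithChanges (suc j) k)
Decompositions↔Σ< n k = mk↔ₛ′ by-length unindex
  (λ { (j , lt , (v , p) , ([] , () , c))
     ; (.(length s) , lt , (v , p) , (x ∷ s , refl , c)) →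
         cong₂ (λ z q → length s , z , (v , q) , (x ∷ s , refl , c)) (≤-irrelevant _ _) (ballotPath-irrelevant _ _) })
  (λ { ((m , v , []) , p , e , c) → ⊥-elim (no-factors p e)
     ; y@((m , v , x ∷ s) , p , e , c) →
         Σ-≡ isDecomposition-irrelevant _ y (cong (λ z → z , v , x ∷ s) (sym (proj₂ (split-length m (length s) e)))) })
  where
  no-factors : ∀ {m v} → BallotPath m 0 v → m + 0 ≢ suc n
  no-factors p e with ballotPath-height-zero p
  ... | refl , refl = 0≢1+n e
  split-length : ∀ m j → m + suc j ≡ suc n → j ≤ n × m ≡ n ∸ j
  split-length m j e = subst (j ≤_) m+j≡n (m≤n+m j m) , sym (trans (cong (_∸ j) (sym m+j≡n)) (m+n∸n≡m m j))
    where
    m+j≡n : m + j ≡ n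
    m+j≡n = suc-injective (trans (sym (+-suc m j)) e)
  unindex : Σ< (suc n) (λ j → BallotPaths (n ∸ j) (suc j) × WordsWithChanges (suc j) k) → Decompositions (suc n) k
  unindex (j , lt , (v , p) , (s , l , c)) =
    (n ∸ j , v , s) , subst (λ z → BallotPath (n ∸ j) z v) (sym l) p ,
    trans (cong (n ∸ j +_) l) (trans (+-suc (n ∸ j) j) (cong suc (m∸n+n≡m (s≤s⁻¹ lt)))) , c
  by-length : Decompositions (suc n) k → Σ< (suc n) (λ j → BallotPaths (n ∸ j) (suc j) × WordsWithChanges (suc j) k)
  by-length ((m , v , []) , p , e , c) = ⊥-elim (no-factors p e)
  by-length ((m , v , x ∷ s) , p , e , c) =
    length s , s≤s (proj₁ split) ,
    (v , subst (λ z → BallotPath z (suc (length s)) v) (proj₂ split) p) , (x ∷ s , refl , c)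
    where
    split : length s ≤ n × m ≡ n ∸ length s
    split = split-length m (length s) e

-- Fillings as words

<ᵇ-true : ∀ {a b} → a < b → (a <ᵇ b) ≡ true
<ᵇ-true {zero}  {suc b} _         = refl
<ᵇ-true {suc a} {suc b} (s≤s a<b) = <ᵇ-true a<b

<ᵇ-false : ∀ {a b} → b ≤ a → (a <ᵇ b) ≡ false
<ᵇ-false {a}     {zero}  _         = refl
<ᵇ-false {suc a} {suc b} (s≤s b≤a) = <ᵇ-false b≤a

≡ᵇ-refl : ∀ a → (a ≡ᵇ a) ≡ true
≡ᵇ-refl zero    = refl
≡ᵇ-refl (suc a) = ≡ᵇ-refl a

≡ᵇ-false : ∀ {a b} → a ≢ b → (a ≡ᵇ b) ≡ false
≡ᵇ-false {zero}  {zero}  a≢b = ⊥-elim (a≢b refl)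
≡ᵇ-false {zero}  {suc b} a≢b = refl
≡ᵇ-false {suc a} {zero}  a≢b = refl
≡ᵇ-false {suc a} {suc b} a≢b = ≡ᵇ-false (λ e → a≢b (cong suc e))

indicator : ℕ → ℕ → ℕ
indicator x y = if x ≡ᵇ y then 1 else 0

occurrences : ℕ → List ℕ → ℕ
occurrences x []      = 0
occurrences x (y ∷ l) = indicator x y + occurrences x l

indicator-self : ∀ x → indicator x x ≡ 1
indicator-self x rewrite ≡ᵇ-refl x = refl

indicator-≢ : ∀ x y → x ≢ y → indicator x y ≡ 0
indicator-≢ x y x≢y rewrite ≡ᵇ-false x≢y = refl

occurrences-++ : ∀ x l l′ → occurrences x (l ++ l′) ≡ occurrences x l + occurrences x l′
occurrences-++ x []      l′ = refl
occurrences-++ x (y ∷ l) l′ =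
  trans (cong (indicator x y +_) (occurrences-++ x l l′)) (sym (+-assoc (indicator x y) _ _))

occurrences-↭ : ∀ x {l l′} → l ↭ l′ → occurrences x l ≡ occurrences x l′
occurrences-↭ x ↭.refl        = refl
occurrences-↭ x (↭.prep y p)  = cong (indicator x y +_) (occurrences-↭ x p)
occurrences-↭ x (↭.swap {xs = l} y z p) =
  trans (sym (+-assoc (indicator x y) _ _))
  (trans (cong (_+ occurrences x l) (+-comm (indicator x y) (indicator x z)))
  (trans (+-assoc (indicator x z) _ _) (cong (λ u → indicator x z + (indicator x y + u)) (occurrences-↭ x p))))
occurrences-↭ x (↭.trans p q) = trans (occurrences-↭ x p) (occurrences-↭ x q)

interval : ℕ → ℕ → List ℕ
interval p zero    = []
interval p (suc m) = p ∷ interval (suc p) m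

applyUpTo-interval : ∀ (f : ℕ → ℕ) p m → (∀ x → f x ≡ p + x) → applyUpTo f m ≡ interval p m
applyUpTo-interval f p zero    e = refl
applyUpTo-interval f p (suc m) e =
  cong₂ _∷_ (trans (e 0) (+-identityʳ p))
            (applyUpTo-interval (λ x → f (suc x)) (suc p) m (λ x → trans (e (suc x)) (+-suc p x)))

map-suc-upTo : ∀ m → map suc (upTo m) ≡ interval 1 m
map-suc-upTo m = trans (map-upTo suc m) (applyUpTo-interval suc 1 m (λ x → refl))

occurrences-interval-below : ∀ {x p} m → x < p → occurrences x (interval p m) ≡ 0
occurrences-interval-below         zero    x<p = refl
occurrences-interval-below {x} {p} (suc m) x<p =
  cong₂ _+_ (indicator-≢ x p (<⇒≢ x<p)) (occurrences-interval-below m (m<n⇒m<1+n x<p))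

occurrences-interval-≤1 : ∀ x p m → occurrences x (interval p m) ≤ 1
occurrences-interval-≤1 x p zero = z≤n
occurrences-interval-≤1 x p (suc m) with x ≟ p
... | yes refl rewrite indicator-self x | occurrences-interval-below {x} m (n<1+n x) = s≤s z≤n
... | no x≢p rewrite indicator-≢ x p x≢p = occurrences-interval-≤1 x (suc p) m

occurrences-interval-bounds : ∀ x p m → 1 ≤ occurrences x (interval p m) → p ≤ x × x < p + m
occurrences-interval-bounds x p zero ()
occurrences-interval-bounds x p (suc m) h with x ≟ p
... | yes refl = ≤-refl , subst (x <_) (sym (+-suc x m)) (s≤s (m≤m+n x m))
... | no x≢p rewrite indicator-≢ x p x≢p with occurrences-interval-bounds x (suc p) m h
...   | p<x , x<p+m = ≤-trans (n≤1+n p) p<x , subst (x <_) (sym (+-suc p m)) x<p+m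

occurrences-interval-inside : ∀ x p m → p ≤ x → x < p + m → occurrences x (interval p m) ≡ 1
occurrences-interval-inside x p zero p≤x x<p+m =
  ⊥-elim (<⇒≱ (subst (x <_) (+-identityʳ p) x<p+m) p≤x)
occurrences-interval-inside x p (suc m) p≤x x<p+m with x ≟ p
... | yes refl rewrite indicator-self x | occurrences-interval-below {x} m (n<1+n x) = refl
... | no x≢p rewrite indicator-≢ x p x≢p =
  occurrences-interval-inside x (suc p) m (≤∧≢⇒< p≤x (≢-sym x≢p)) (subst (x <_) (+-suc p m) x<p+m)

topRow : ℕ → List Bool → List ℕ
topRow p []          = []
topRow p (true ∷ w)  = p ∷ topRow (suc p) w
topRow p (false ∷ w) = topRow (suc p) w

bottomRow : ℕ → List Bool → List ℕ
bottomRow p []          = []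
bottomRow p (true ∷ w)  = bottomRow (suc p) w
bottomRow p (false ∷ w) = p ∷ bottomRow (suc p) w

bottomRow≡topRow-not : ∀ p w → bottomRow p w ≡ topRow p (map not w)
bottomRow≡topRow-not p []          = refl
bottomRow≡topRow-not p (true ∷ w)  = bottomRow≡topRow-not (suc p) w
bottomRow≡topRow-not p (false ∷ w) = cong (p ∷_) (bottomRow≡topRow-not (suc p) w)

length-topRow : ∀ p w → length (topRow p w) ≡ trues w
length-topRow p []          = refl
length-topRow p (true ∷ w)  = cong suc (length-topRow (suc p) w)
length-topRow p (false ∷ w) = length-topRow (suc p) w

length-bottomRow : ∀ p w → length (bottomRow p w) ≡ falses w
length-bottomRow p []          = refl
length-bottomRow p (true ∷ w)  = length-bottomRow (suc p) w
length-bottomRow p (false ∷ w) = cong suc (length-bottomRow (suc p) w)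

rows-↭-interval : ∀ p w → topRow p w ++ bottomRow p w ↭ interval p (length w)
rows-↭-interval p []          = ↭.refl
rows-↭-interval p (true ∷ w)  = ↭.prep p (rows-↭-interval (suc p) w)
rows-↭-interval p (false ∷ w) =
  ↭-trans (shift p (topRow (suc p) w) (bottomRow (suc p) w)) (↭.prep p (rows-↭-interval (suc p) w))

Increasing : List ℕ → Set
Increasing []      = ⊤
Increasing (x ∷ l) = All (x <_) l × Increasing l

topRow-increasing : ∀ p w → Increasing (topRow p w) × All (p ≤_) (topRow p w)
topRow-increasing p [] = tt , []
topRow-increasing p (true ∷ w) with topRow-increasing (suc p) w
... | inc , above = (above , inc) , (≤-refl ∷ All.map (≤-trans (n≤1+n p)) above)
topRow-increasing p (false ∷ w) with topRow-increasing (suc p) w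
... | inc , above = inc , All.map (≤-trans (n≤1+n p)) above

bottomRow-increasing : ∀ p w → Increasing (bottomRow p w) × All (p ≤_) (bottomRow p w)
bottomRow-increasing p w rewrite bottomRow≡topRow-not p w = topRow-increasing p (map not w)

isPositive : ℕ → Bool
isPositive zero    = false
isPositive (suc _) = true

occurrences-above : ∀ {p x} l → All (p ≤_) l → x < p → occurrences x l ≡ 0
occurrences-above         []      []         x<p = refl
occurrences-above {p} {x} (y ∷ l) (p≤y ∷ ps) x<p =
  cong₂ _+_ (indicator-≢ x y (<⇒≢ (<-≤-trans x<p p≤y))) (occurrences-above l ps x<p)

map-interval-cong : ∀ (f g : ℕ → Bool) p m → (∀ {x} → p ≤ x → x < p + m → f x ≡ g x) →
                    map f (interval p m) ≡ map g (interval p m)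
map-interval-cong f g p zero    e = refl
map-interval-cong f g p (suc m) e =
  cong₂ _∷_ (e ≤-refl (subst (p <_) (sym (+-suc p m)) (s≤s (m≤m+n p m))))
            (map-interval-cong f g (suc p) m (λ {x} p<x x<p+m → e (<⇒≤ p<x) (subst (x <_) (sym (+-suc p m)) x<p+m)))

wordOf-topRow : ∀ p w → map (λ x → isPositive (occurrences x (topRow p w))) (interval p (length w)) ≡ w
wordOf-topRow p [] = refl
wordOf-topRow p (true ∷ w) rewrite indicator-self p =
  cong (true ∷_) (trans (map-interval-cong _ _ (suc p) (length w)
                          (λ {x} p<x _ → cong (λ z → isPositive (z + occurrences x (topRow (suc p) w))) (indicator-≢ x p (>⇒≢ p<x))))
                        (wordOf-topRow (suc p) w))
wordOf-topRow p (false ∷ w) rewrite occurrences-above {suc p} {p} (topRow (suc p) w) (proj₂ (topRow-increasing (suc p) w)) ≤-refl =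
  cong (false ∷_) (wordOf-topRow (suc p) w)

topRow-occurrences : ∀ len p l → Increasing l → All (p ≤_) l → All (_< p + len) l →
  topRow p (map (λ x → isPositive (occurrences x l)) (interval p len)) ≡ l
topRow-occurrences-absent : ∀ len p l → Increasing l → All (suc p ≤_) l → All (_< p + suc len) l →
  topRow p (map (λ x → isPositive (occurrences x l)) (interval p (suc len))) ≡ l

topRow-occurrences zero p [] _ _ _ = refl
topRow-occurrences zero p (y ∷ l) _ (p≤y ∷ _) (y<p+0 ∷ _) =
  ⊥-elim (<⇒≱ (subst (y <_) (+-identityʳ p) y<p+0) p≤y)
topRow-occurrences (suc len) p [] _ _ _ = topRow-occurrences-absent len p [] tt [] []
topRow-occurrences (suc len) p (y ∷ l) (y<l , inc) (p≤y ∷ above) (y<p+len ∷ below) with y ≟ p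
... | yes refl rewrite indicator-self y =
  cong (y ∷_) (trans (cong (topRow (suc y)) (map-interval-cong _ _ (suc y) len
                        (λ {x} y<x _ → cong (λ z → isPositive (z + occurrences x l)) (indicator-≢ x y (>⇒≢ y<x)))))
                      (topRow-occurrences len (suc y) l inc y<l (All.map (λ {x} → subst (x <_) (+-suc y len)) below)))
... | no y≢p = topRow-occurrences-absent len p (y ∷ l) (y<l , inc) (p<y ∷ All.map (<-trans p<y) y<l) (y<p+len ∷ below)
  where
  p<y : p < y
  p<y = ≤∧≢⇒< p≤y (≢-sym y≢p)

topRow-occurrences-absent len p l inc above below rewrite occurrences-above l above (n<1+n p) =
  topRow-occurrences len (suc p) l inc above (All.map (λ {x} → subst (x <_) (+-suc p len)) below)

columnSigns-[] : ∀ h σ → columnSigns h σ [] ≡ []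
columnSigns-[] zero    σ = refl
columnSigns-[] (suc h) σ = refl

columnSigns-open : ∀ h σ w → columnSigns (suc h) σ w ≡ columnSigns h σ (σ ∷ w)
columnSigns-open zero    true  w = refl
columnSigns-open zero    false w = refl
columnSigns-open (suc h) true  w = refl
columnSigns-open (suc h) false w = refl

-- Columns are filled first-in first-out: the queue q holds the h entries
-- of the current factor still waiting for a partner in the other row.
zipWith-queuedTop : ∀ q p w h → length q ≡ h → All (_< p) q →
  zipWith _<ᵇ_ (q ++ topRow p w) (bottomRow p w) ≡ columnSigns h true w
zipWith-queuedBottom : ∀ q p w h → length q ≡ h → All (_< p) q →
  zipWith _<ᵇ_ (topRow p w) (q ++ bottomRow p w) ≡ columnSigns h false w

zipWith-queuedTop q p [] h e q<p =
  trans (cong (λ l → zipWith _<ᵇ_ l []) (++-identityʳ q)) (trans (zipWith-[]ʳ q) (sym (columnSigns-[] h true)))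
  where
  zipWith-[]ʳ : ∀ (l : List ℕ) → zipWith _<ᵇ_ l [] ≡ []
  zipWith-[]ʳ []      = refl
  zipWith-[]ʳ (_ ∷ _) = refl
zipWith-queuedTop q p (true ∷ w) h e q<p =
  trans (cong (λ l → zipWith _<ᵇ_ l (bottomRow (suc p) w)) (sym (++-assoc q [ p ] (topRow (suc p) w))))
  (trans (zipWith-queuedTop (q ++ [ p ]) (suc p) w (suc h) (trans (length-++ q) (trans (+-comm (length q) 1) (cong suc e)))
                             (++⁺ (All.map m<n⇒m<1+n q<p) (≤-refl ∷ [])))
         (columnSigns-open h true w))
zipWith-queuedTop []      p (false ∷ w) zero    e q<p = zipWith-queuedBottom [ p ] (suc p) w 1 refl (≤-refl ∷ [])
zipWith-queuedTop (x ∷ q) p (false ∷ w) (suc h) e (x<p ∷ q<p) rewrite <ᵇ-true x<p =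
  cong (true ∷_) (zipWith-queuedTop q (suc p) w h (suc-injective e) (All.map m<n⇒m<1+n q<p))

zipWith-queuedBottom q p [] h e q<p = sym (columnSigns-[] h false)
zipWith-queuedBottom q p (false ∷ w) h e q<p =
  trans (cong (zipWith _<ᵇ_ (topRow (suc p) w)) (sym (++-assoc q [ p ] (bottomRow (suc p) w))))
  (trans (zipWith-queuedBottom (q ++ [ p ]) (suc p) w (suc h) (trans (length-++ q) (trans (+-comm (length q) 1) (cong suc e)))
                                (++⁺ (All.map m<n⇒m<1+n q<p) (≤-refl ∷ [])))
         (columnSigns-open h false w))
zipWith-queuedBottom []      p (true ∷ w) zero    e q<p = zipWith-queuedTop [ p ] (suc p) w 1 refl (≤-refl ∷ [])
zipWith-queuedBottom (x ∷ q) p (true ∷ w) (suc h) e (x<p ∷ q<p) rewrite <ᵇ-false (<⇒≤ x<p) =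
  cong (false ∷_) (zipWith-queuedBottom q (suc p) w h (suc-injective e) (All.map m<n⇒m<1+n q<p))

DistinctColumns : List ℕ → List ℕ → Set
DistinctColumns (a ∷ l) (b ∷ l′) = a ≢ b × DistinctColumns l l′
DistinctColumns _       _        = ⊤

<ᵇ-flip : ∀ {a b} → a ≢ b → (b <ᵇ a) ≡ not (a <ᵇ b)
<ᵇ-flip {a} {b} a≢b with <-cmp a b
... | tri< a<b _ _ rewrite <ᵇ-true a<b | <ᵇ-false (<⇒≤ a<b) = refl
... | tri≈ _ a≡b _ = ⊥-elim (a≢b a≡b)
... | tri> _ _ b<a rewrite <ᵇ-true b<a | <ᵇ-false (<⇒≤ b<a) = refl

-- A column is an inversion iff the row of its smaller entry differs from the
-- next column's (for the last column: iff the smaller entry is in the bottom row).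
invsRows≡changes : ∀ l l′ → length l ≡ length l′ → DistinctColumns l l′ →
                   invsRows l l′ ≡ changes (zipWith _<ᵇ_ l l′ ++ [ true ])
invsRows≡changes []      []       e d = refl
invsRows≡changes (a ∷ []) (b ∷ []) e d with a <ᵇ b
... | true  = refl
... | false = refl
invsRows≡changes (a ∷ a′ ∷ l) (b ∷ b′ ∷ l′) e (_ , a′≢b′ , d) =
  first-column a′≢b′ (invsRows≡changes (a′ ∷ l) (b′ ∷ l′) (suc-injective e) (a′≢b′ , d))
  where
  first-column : a′ ≢ b′ → invsRows (a′ ∷ l) (b′ ∷ l′) ≡ changes (zipWith _<ᵇ_ (a′ ∷ l) (b′ ∷ l′) ++ [ true ]) →
                 invsRows (a ∷ a′ ∷ l) (b ∷ b′ ∷ l′) ≡ changes (zipWith _<ᵇ_ (a ∷ a′ ∷ l) (b ∷ b′ ∷ l′) ++ [ true ])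
  first-column a′≢b′ ih rewrite <ᵇ-flip a′≢b′ | ≡ᵇ-false a′≢b′ | ≡ᵇ-false (≢-sym a′≢b′) =
    cong₂ _+_ (agree (a <ᵇ b) (a′ <ᵇ b′)) ih
    where
    agree : ∀ c c′ → (if c then (if (if not c′ then true else false) then 1 else 0)
                            else (if (if c′ then true else false) then 1 else 0)) ≡ bit (c xor c′)
    agree true  true  = refl
    agree true  false = refl
    agree false true  = refl
    agree false false = refl
invsRows≡changes []          (_ ∷ _)      () d
invsRows≡changes (_ ∷ _)     []           () d
invsRows≡changes (a ∷ [])    (b ∷ _ ∷ _)  () d
invsRows≡changes (a ∷ _ ∷ _) (b ∷ [])     () d

occurrences⇒DistinctColumns : ∀ l l′ → (∀ x → occurrences x l + occurrences x l′ ≤ 1) → DistinctColumns l l′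
occurrences⇒DistinctColumns []      l′       h = tt
occurrences⇒DistinctColumns (a ∷ l) []       h = tt
occurrences⇒DistinctColumns (a ∷ l) (b ∷ l′) h = a≢b , occurrences⇒DistinctColumns l l′ (λ x →
  ≤-trans (+-mono-≤ (m≤n+m (occurrences x l) (indicator x a)) (m≤n+m (occurrences x l′) (indicator x b))) (h x))
  where
  a≢b : a ≢ b
  a≢b refl with h a
  ... | twice rewrite indicator-self a with subst (_≤ 0) (+-suc (occurrences a l) (occurrences a l′)) (s≤s⁻¹ twice)
  ...   | ()

occurrences-rows : ∀ x p w →
  occurrences x (topRow p w) + occurrences x (bottomRow p w) ≡ occurrences x (interval p (length w))
occurrences-rows x p w =
  trans (sym (occurrences-++ x (topRow p w) (bottomRow p w))) (occurrences-↭ x (rows-↭-interval p w))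

inversions-rows : ∀ w → trues w ≡ falses w →
  invsRows (topRow 1 w) (bottomRow 1 w) ≡ changes (columnSigns 0 true w ++ [ true ])
inversions-rows w t≡f =
  trans (invsRows≡changes (topRow 1 w) (bottomRow 1 w)
           (trans (length-topRow 1 w) (trans t≡f (sym (length-bottomRow 1 w))))
           (occurrences⇒DistinctColumns _ _ (λ x →
              subst (_≤ 1) (sym (occurrences-rows x 1 w)) (occurrences-interval-≤1 x 1 (length w)))))
        (cong (λ z → changes (z ++ [ true ])) (zipWith-queuedTop [] 1 w 0 refl []))

listToVec : ∀ {n} (l : List ℕ) → length l ≡ n → Vec ℕ n
listToVec {zero}  []      e  = []
listToVec {suc n} (x ∷ l) e  = x ∷ listToVec l (suc-injective e)

toList-listToVec : ∀ {n} l (e : length l ≡ n) → toList (listToVec l e) ≡ l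
toList-listToVec {zero}  []      e = refl
toList-listToVec {suc n} (x ∷ l) e = cong (x ∷_) (toList-listToVec l (suc-injective e))

lookup-listToVec : ∀ {P : ℕ → Set} {n} l (e : length l ≡ n) → All P l → ∀ a → P (lookup (listToVec l e) a)
lookup-listToVec {n = suc n} (x ∷ l) e (px ∷ _)  Fin.zero    = px
lookup-listToVec {n = suc n} (x ∷ l) e (_  ∷ pl) (Fin.suc a) = lookup-listToVec l (suc-injective e) pl a

increasing⇒lookup< : ∀ {n} l (e : length l ≡ n) → Increasing l →
                     ∀ (a b : Fin n) → a Fin.< b → lookup (listToVec l e) a < lookup (listToVec l e) b
increasing⇒lookup< {suc n} (x ∷ l) e (x<l , inc) Fin.zero    (Fin.suc b) a<b = lookup-listToVec l (suc-injective e) x<l b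
increasing⇒lookup< {suc n} (x ∷ l) e (x<l , inc) (Fin.suc a) (Fin.suc b) a<b =
  increasing⇒lookup< l (suc-injective e) inc a b (s≤s⁻¹ a<b)

lookup<⇒increasing : ∀ {n} (v : Vec ℕ n) → (∀ (a b : Fin n) → a Fin.< b → lookup v a < lookup v b) →
                     Increasing (toList v)
lookup<⇒increasing [] inc = tt
lookup<⇒increasing (x ∷ v) inc =
  lookup⇒All v (λ b → inc Fin.zero (Fin.suc b) (s≤s z≤n)) ,
  lookup<⇒increasing v (λ a b a<b → inc (Fin.suc a) (Fin.suc b) (s≤s a<b))
  where
  lookup⇒All : ∀ {P : ℕ → Set} {n} (v : Vec ℕ n) → (∀ i → P (lookup v i)) → All P (toList v)
  lookup⇒All []      f = []
  lookup⇒All (x ∷ v) f = f Fin.zero ∷ lookup⇒All v (λ i → f (Fin.suc i))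

All-occurring : ∀ {P : ℕ → Set} l → (∀ x → 1 ≤ occurrences x l → P x) → All P l
All-occurring []      f = []
All-occurring (y ∷ l) f =
  f y (subst (λ z → 1 ≤ z + occurrences y l) (sym (indicator-self y)) (s≤s z≤n)) ∷
  All-occurring l (λ x h → f x (≤-trans h (m≤n+m (occurrences x l) (indicator x y))))

length-words : ∀ {n} w → trues w ≡ n → falses w ≡ n → length w ≡ n + n
length-words w t f = trans (sym (trues+falses w)) (cong₂ _+_ t f)

fillingOf : ∀ {n} w → trues w ≡ n → falses w ≡ n → Filling n
fillingOf {n} w t f = record
  { top = listToVec (topRow 1 w) t′
  ; bot = listToVec (bottomRow 1 w) f′
  ; topInc = increasing⇒lookup< (topRow 1 w) t′ (proj₁ (topRow-increasing 1 w))
  ; botInc = increasing⇒lookup< (bottomRow 1 w) f′ (proj₁ (bottomRow-increasing 1 w))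
  ; usesEachOnce = subst₂ (λ u z → u ++ z ↭ map suc (upTo (n + n)))
      (sym (toList-listToVec (topRow 1 w) t′)) (sym (toList-listToVec (bottomRow 1 w) f′))
      (subst (topRow 1 w ++ bottomRow 1 w ↭_) (trans (cong (interval 1) (length-words w t f)) (sym (map-suc-upTo (n + n))))
             (rows-↭-interval 1 w))
  }
  where
  t′ = trans (length-topRow 1 w) t
  f′ = trans (length-bottomRow 1 w) f

toList-top-fillingOf : ∀ {n} w (t : trues w ≡ n) (f : falses w ≡ n) → toList (top (fillingOf w t f)) ≡ topRow 1 w
toList-top-fillingOf w t f = toList-listToVec (topRow 1 w) (trans (length-topRow 1 w) t)

toList-bot-fillingOf : ∀ {n} w (t : trues w ≡ n) (f : falses w ≡ n) → toList (bot (fillingOf w t f)) ≡ bottomRow 1 w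
toList-bot-fillingOf w t f = toList-listToVec (bottomRow 1 w) (trans (length-bottomRow 1 w) f)

wordOf : ∀ {n} → Filling n → List Bool
wordOf {n} F = map (λ x → isPositive (occurrences x (toList (top F)))) (interval 1 (n + n))

top-increasing : ∀ {n} (F : Filling n) → Increasing (toList (top F))
top-increasing record { top = t ; topInc = inc } = lookup<⇒increasing t (λ a b a<b → recompute (_ <? _) (inc a b a<b))

bot-increasing : ∀ {n} (F : Filling n) → Increasing (toList (bot F))
bot-increasing record { bot = b ; botInc = inc } = lookup<⇒increasing b (λ a b a<b → recompute (_ <? _) (inc a b a<b))

occurrences-filling : ∀ {n} (F : Filling n) x →
  occurrences x (toList (top F)) + occurrences x (toList (bot F)) ≡ occurrences x (interval 1 (n + n))
occurrences-filling {n} record { top = t ; bot = b ; usesEachOnce = u } x = recompute (_ ≟ _)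
  (trans (sym (occurrences-++ x (toList t) (toList b)))
         (trans (occurrences-↭ x u) (cong (occurrences x) (map-suc-upTo (n + n)))))

module OfFilling {n} (F : Filling n) where

  T = toList (top F)
  B′ = toList (bot F)
  w = wordOf F

  in-range : ∀ l → (∀ x → occurrences x l ≤ occurrences x (interval 1 (n + n))) → All (λ x → 1 ≤ x × x < 1 + (n + n)) l
  in-range l h = All-occurring l (λ x o → occurrences-interval-bounds x 1 (n + n) (≤-trans o (h x)))

  range-T : All (λ x → 1 ≤ x × x < 1 + (n + n)) T
  range-T = in-range T (λ x → subst (occurrences x T ≤_) (occurrences-filling F x) (m≤m+n _ _))

  range-B : All (λ x → 1 ≤ x × x < 1 + (n + n)) B′
  range-B = in-range B′ (λ x → subst (occurrences x B′ ≤_) (occurrences-filling F x) (m≤n+m _ _))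

  topRow-w : topRow 1 w ≡ T
  topRow-w = topRow-occurrences (n + n) 1 T (top-increasing F) (All.map proj₁ range-T) (All.map proj₂ range-T)

  complement : ∀ {x} → 1 ≤ x → x < 1 + (n + n) → not (isPositive (occurrences x T)) ≡ isPositive (occurrences x B′)
  complement {x} 1≤x x<1+2n = one-of (occurrences x T) (occurrences x B′)
    (trans (occurrences-filling F x) (occurrences-interval-inside x 1 (n + n) 1≤x x<1+2n))
    where
    one-of : ∀ a b → a + b ≡ 1 → not (isPositive a) ≡ isPositive b
    one-of zero          (suc zero) e = refl
    one-of (suc zero)    zero       e = refl
    one-of zero          zero       ()
    one-of zero          (suc (suc b)) ()
    one-of (suc zero)    (suc b)    ()
    one-of (suc (suc a)) b          ()

  bottomRow-w : bottomRow 1 w ≡ B′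
  bottomRow-w = begin
      bottomRow 1 w
    ≡⟨ bottomRow≡topRow-not 1 w ⟩
      topRow 1 (map not w)
    ≡⟨ cong (topRow 1) (sym (map-∘ (interval 1 (n + n)))) ⟩
      topRow 1 (map (λ x → not (isPositive (occurrences x T))) (interval 1 (n + n)))
    ≡⟨ cong (topRow 1) (map-interval-cong _ _ 1 (n + n) complement) ⟩
      topRow 1 (map (λ x → isPositive (occurrences x B′)) (interval 1 (n + n)))
    ≡⟨ topRow-occurrences (n + n) 1 B′ (bot-increasing F) (All.map proj₁ range-B) (All.map proj₂ range-B) ⟩
      B′
    ∎
    where open ≡-Reasoning

  trues-w : trues w ≡ n
  trues-w = trans (sym (length-topRow 1 w)) (trans (cong length topRow-w) (length-toList (top F)))

  falses-w : falses w ≡ n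
  falses-w = trans (sym (length-bottomRow 1 w)) (trans (cong length bottomRow-w) (length-toList (bot F)))

filling-≡ : ∀ {n} {F G : Filling n} → top F ≡ top G → bot F ≡ bot G → F ≡ G
filling-≡ {F = record { top = t ; bot = b }} {G = record { top = .t ; bot = .b }} refl refl = refl

toList-injective′ : ∀ {n} (u v : Vec ℕ n) → toList u ≡ toList v → u ≡ v
toList-injective′ u v e = trans (sym (cast-is-id refl u)) (toList-injective refl u v e)

BalancedWords↔S : ∀ n k → BalancedWords n k ↔ S n k
BalancedWords↔S n k = mk↔ₛ′ to from
  (λ x@(F , _) → let open OfFilling F in
     Σ-≡ (λ _ → ≡-irrelevant) _ x
       (filling-≡ (toList-injective′ _ _ (trans (toList-top-fillingOf w trues-w falses-w) topRow-w))
                  (toList-injective′ _ _ (trans (toList-bot-fillingOf w trues-w falses-w) bottomRow-w))))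
  (λ x@(w , (t , f) , _) → Σ-≡ isBalanced-irrelevant _ x (begin
      wordOf (fillingOf w t f)
    ≡⟨ map-interval-cong _ _ 1 (n + n) (λ {y} _ _ →
         cong (λ l → isPositive (occurrences y l)) (toList-top-fillingOf w t f)) ⟩
      map (λ y → isPositive (occurrences y (topRow 1 w))) (interval 1 (n + n))
    ≡⟨ cong (λ m → map (λ y → isPositive (occurrences y (topRow 1 w))) (interval 1 m)) (sym (length-words w t f)) ⟩
      map (λ y → isPositive (occurrences y (topRow 1 w))) (interval 1 (length w))
    ≡⟨ wordOf-topRow 1 w ⟩
      w
    ∎))
  where
  open ≡-Reasoning
  to : BalancedWords n k → S n k
  to (w , (t , f) , c) = fillingOf w t f ,
    trans (cong₂ invsRows (toList-top-fillingOf w t f) (toList-bot-fillingOf w t f))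
          (trans (inversions-rows w (trans t (sym f))) c)
  from : S n k → BalancedWords n k
  from (F , i) = w , (trues-w , falses-w) ,
    trans (sym (inversions-rows w (trans trues-w (sym falses-w)))) (trans (cong₂ invsRows topRow-w bottomRow-w) i)
    where open OfFilling F

B≡ballotCount : ∀ {m j} → j ≤ m → B m (m ∸ j) ≡ ballotCount (m ∸ j) (suc j)
B≡ballotCount {m} {j} j≤m =
  subst (λ n → B n (m ∸ j) ≡ ballotCount (m ∸ j) (suc j)) (m∸n+n≡m j≤m) (B-ballotCount (m ∸ j) j)

closedForm≡ballotCount : ∀ {m j} → j ≤ m →
  (suc j * ((suc m + suc m ∸ suc j ∸ 1) C (suc m ∸ suc j))) / suc m ≡ ballotCount (m ∸ j) (suc j)
closedForm≡ballotCount {m} {j} j≤m =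
  subst (λ n → (suc j * ((suc n + suc n ∸ suc j ∸ 1) C (suc n ∸ suc j))) / suc n ≡ ballotCount (m ∸ j) (suc j))
        (m∸n+n≡m j≤m) (closedForm-ballotCount (m ∸ j) j)

ballotTerm↔ : ∀ {m j} k → j ≤ m →
  Fin (B m (m ∸ j) * (suc j C k)) ↔ (BallotPaths (m ∸ j) (suc j) × WordsWithChanges (suc j) k)
ballotTerm↔ {m} {j} k j≤m = ↔-trans *↔×
  (↔-trans (≡⇒ (cong Fin (B≡ballotCount j≤m))) (Fin↔BallotPaths (m ∸ j) (suc j))
   ×-↔ Fin↔WordsWithChanges (suc j) k)

mainTheorem3 : (m k : ℕ) →
    let n = suc m in
    (Fin (Σ₁ n (λ i → B (n ∸ 1) (n ∸ i) * (i C k))) ↔ S n k)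
    × (Σ₁ n (λ i → B (n ∸ 1) (n ∸ i) * (i C k))
       ≡ Σ₁ n (λ i → ((i * ((n + n ∸ i ∸ 1) C (n ∸ i))) / n) * (i C k)))
mainTheorem3 m k = bijection , closedForm
  where
  open EquationalReasoning
  bijection : Fin (Σ₁ (suc m) (λ i → B m (suc m ∸ i) * (i C k))) ↔ S (suc m) k
  bijection = begin
      Fin (Σ₁ (suc m) (λ i → B m (suc m ∸ i) * (i C k)))
    ↔⟨ Fin-sum↔Σ< _ (λ j → j) (suc m) ⟩
      Σ< (suc m) (λ j → Fin (B m (m ∸ j) * (suc j C k)))
    ↔⟨ Σ<-cong (suc m) (λ j<1+m → ballotTerm↔ k (s≤s⁻¹ j<1+m)) ⟩
      Σ< (suc m) (λ j → BallotPaths (m ∸ j) (suc j) × WordsWithChanges (suc j) k)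
    ↔⟨ ↔-sym (Decompositions↔Σ< m k) ⟩
      Decompositions (suc m) k
    ↔⟨ ↔-sym (BalancedWords↔Decompositions (suc m) k) ⟩
      BalancedWords (suc m) k
    ↔⟨ BalancedWords↔S (suc m) k ⟩
      S (suc m) k
    ∎
  closedForm : Σ₁ (suc m) (λ i → B m (suc m ∸ i) * (i C k))
             ≡ Σ₁ (suc m) (λ i → ((i * ((suc m + suc m ∸ i ∸ 1) C (suc m ∸ i))) / suc m) * (i C k))
  closedForm = sum-cong _ _ (λ j → j) (suc m) (λ {j} j<1+m →
    cong (_* (suc j C k)) (trans (B≡ballotCount (s≤s⁻¹ j<1+m)) (sym (closedForm≡ballotCount (s≤s⁻¹ j<1+m)))))
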